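{- Fix an integer $d\ge 2$ and an even set $A\subseteq \mathbb{Q}^d$. Then \[|\partial A|\ge \min\left\{|B\cup \partial B|: B\subseteq \mathbb{Q}^{d-1},\, |B| = |A|\right\},\] where $\partial A$ is taken in $\mathbb{Q}^d$ and $\partial B$ in $\mathbb{Q}^{d-1}$.
   Context: $\mathbb{Q}^d$ is the hypercube graph with vertex set $\{1,2\}^d$, two vertices adjacent iff they differ in exactly one coordinate. For a vertex set $A$ of a hypercube, $\partial A$ is the set of vertices at graph distance exactly $1$ from $A$. A vertex is even if the sum of its coordinates is even and odd otherwise; a set of vertices is even if all its vertices are even. -}

module Defs where

open import Data.Bool using (Bool; true; false; not; _∧_; _∨_; if_then_else_)
open import Data.Nat using (ℕ; zero; suc; _+_)
open import Data.Nat.Properties using (_≟_)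
open import Data.Vec using (Vec; []; _∷_)
open import Data.List using (List; []; _∷_; _++_; map; filter; length)
open import Data.Bool.ListAction using (any)
open import Relation.Nullary.Decidable using (⌊_⌋)

-- Vertices of the hypercube Q^d = {1,2}^d; false encodes coordinate 1,
-- true encodes coordinate 2.
Vertex : ℕ → Set
Vertex d = Vec Bool d

allVertices : (d : ℕ) → List (Vertex d)
allVertices zero = [] ∷ []
allVertices (suc d) = map (false ∷_) (allVertices d) ++ map (true ∷_) (allVertices d)

VSet : ℕ → Set
VSet d = Vertex d → Bool

-- Hamming distance = graph distance in Q^d.
dist : {d : ℕ} → Vertex d → Vertex d → ℕ
dist [] [] = 0
dist (x ∷ u) (y ∷ v) = (if x Data.Bool.xor y then 1 else 0) + dist u v
  where import Data.Bool

∣_∣ : {d : ℕ} → VSet d → ℕ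
∣_∣ {d} A = length (filter (λ v → Data.Bool.T? (A v)) (allVertices d))
  where import Data.Bool

∂ : {d : ℕ} → VSet d → VSet d
∂ {d} A v = not (A v) ∧ any (λ u → A u ∧ ⌊ dist u v ≟ 1 ⌋) (allVertices d)

_∪_ : {d : ℕ} → VSet d → VSet d → VSet d
(A ∪ B) v = A v ∨ B v

twos : {d : ℕ} → Vertex d → ℕ
twos [] = 0
twos (true ∷ v) = suc (twos v)
twos (false ∷ v) = twos v

isEvenℕ : ℕ → Bool
isEvenℕ zero = true
isEvenℕ (suc n) = not (isEvenℕ n)

coordSum : {d : ℕ} → Vertex d → ℕ
coordSum {d} v = d + twos v

EvenVertex : {d : ℕ} → Vertex d → Set
EvenVertex v = Data.Bool.T (isEvenℕ (coordSum v))
  where import Data.Bool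

EvenSet : {d : ℕ} → VSet d → Set
EvenSet {d} A = (v : Vertex d) → Data.Bool.T (A v) → EvenVertex v
  where import Data.Bool

{-# OPTIONS --safe #-}
-- Project A onto the last d − 1 coordinates. Two vertices in the same fibre are adjacent, so they
-- have different parities and an even set meets each fibre at most once: the projection B has
-- exactly |A| elements. Over every b ∈ B ∪ ∂B the odd vertex of the fibre is not in A but is
-- adjacent to the even lift of b (if b ∈ B) or of a neighbour of b in B (if b ∈ ∂B), which lies in A.
-- Hence b ↦ (odd lift of b) injects B ∪ ∂B into ∂A.
module Submission where

open import Defs
open import Data.Nat using (ℕ; suc; _≤_)
open import Data.Product using (Σ; _×_)
open import Relation.Binary.PropositionalEquality using (_≡_)

open import Algebra.Properties.CommutativeSemigroup using (interchange)
open import Data.Bool using (Bool; true; false; not; _∨_; _xor_; T; T?; if_then_else_)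
open import Data.Bool.Properties using (T-∧; T-∨; xor-same; xor-inverseʳ; not-¬; not-involutive)
open import Data.Empty using (⊥-elim)
open import Data.List using (List; []; _∷_; _++_; map; filter; length)
open import Data.List.Membership.Propositional using (_∈_; lose)
open import Data.List.Membership.Propositional.Properties using (∈-map⁺; ∈-++⁺ˡ; ∈-++⁺ʳ)
open import Data.List.Properties using (map-++; map-∘; map-cong)
open import Data.List.Relation.Unary.Any using (here; satisfied)
open import Data.List.Relation.Unary.Any.Properties using (any⁺; any⁻)
open import Data.Nat using (_+_; z≤n)
open import Data.Nat.ListAction using (sum)
open import Data.Nat.ListAction.Properties using (sum-++)
open import Data.Nat.Properties
  using (+-mono-≤; +-suc; suc-injective; m≤m+n; m≤n+m; ≤-refl; ≤-trans; +-commutativeSemigroup; module ≤-Reasoning)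
open import Data.Product using (∃; _,_; proj₂)
open import Data.Sum using (inj₁; inj₂)
open import Data.Vec using ([]; _∷_)
open import Function using (_∘_; Equivalence)
open import Relation.Binary.PropositionalEquality using (refl; sym; trans; cong; cong₂; subst; module ≡-Reasoning)
open import Relation.Nullary using (¬_)
open import Relation.Nullary.Decidable using (fromWitness; toWitness)

open Equivalence using (to; from)

χ : Bool → ℕ
χ b = if b then 1 else 0

χ-mono : {x y : Bool} → (T x → T y) → χ x ≤ χ y
χ-mono {false}         _   = z≤n
χ-mono {true}  {true}  _   = ≤-refl
χ-mono {true}  {false} x⇒y = ⊥-elim (x⇒y _)

χ-∨-disjoint : {x y : Bool} → ¬ (T x × T y) → χ (x ∨ y) ≡ χ x + χ y
χ-∨-disjoint {false}         _    = refl
χ-∨-disjoint {true}  {false} _    = refl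
χ-∨-disjoint {true}  {true}  ¬x∧y = ⊥-elim (¬x∧y (_ , _))

T-not-intro : {x : Bool} → ¬ T x → T (not x)
T-not-intro {false} _  = _
T-not-intro {true}  ¬x = ¬x _

length-filter-T? : {X : Set} (p : X → Bool) (xs : List X) →
  length (filter (T? ∘ p) xs) ≡ sum (map (χ ∘ p) xs)
length-filter-T? p []       = refl
length-filter-T? p (x ∷ xs) with p x
... | true  = cong suc (length-filter-T? p xs)
... | false = length-filter-T? p xs

sum-map-mono : {X : Set} {f g : X → ℕ} → (∀ x → f x ≤ g x) → (xs : List X) →
  sum (map f xs) ≤ sum (map g xs)
sum-map-mono f≤g []       = z≤n
sum-map-mono f≤g (x ∷ xs) = +-mono-≤ (f≤g x) (sum-map-mono f≤g xs)

sum-map-+ : {X : Set} (f g : X → ℕ) (xs : List X) →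
  sum (map (λ x → f x + g x) xs) ≡ sum (map f xs) + sum (map g xs)
sum-map-+ f g []       = refl
sum-map-+ f g (x ∷ xs) =
  trans (cong (f x + g x +_) (sum-map-+ f g xs)) (interchange +-commutativeSemigroup (f x) (g x) _ _)

∈-allVertices : {d : ℕ} (v : Vertex d) → v ∈ allVertices d
∈-allVertices []          = here refl
∈-allVertices (false ∷ v) = ∈-++⁺ˡ (∈-map⁺ (false ∷_) (∈-allVertices v))
∈-allVertices (true ∷ v)  = ∈-++⁺ʳ _ (∈-map⁺ (true ∷_) (∈-allVertices v))

∑ : {d : ℕ} → (Vertex d → ℕ) → ℕ
∑ {d} f = sum (map f (allVertices d))

∑-mono : {d : ℕ} {f g : Vertex d → ℕ} → (∀ v → f v ≤ g v) → ∑ f ≤ ∑ g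
∑-mono {d} f≤g = sum-map-mono f≤g (allVertices d)

∑-cong : {d : ℕ} {f g : Vertex d → ℕ} → (∀ v → f v ≡ g v) → ∑ f ≡ ∑ g
∑-cong {d} f≗g = cong sum (map-cong f≗g (allVertices d))

∑-suc : {d : ℕ} (f : Vertex (suc d) → ℕ) → ∑ f ≡ ∑ (λ b → f (false ∷ b) + f (true ∷ b))
∑-suc {d} f = begin
  sum (map f (map (false ∷_) V ++ map (true ∷_) V))
    ≡⟨ cong sum (map-++ f (map (false ∷_) V) _) ⟩
  sum (map f (map (false ∷_) V) ++ map f (map (true ∷_) V))
    ≡⟨ sum-++ (map f (map (false ∷_) V)) _ ⟩
  sum (map f (map (false ∷_) V)) + sum (map f (map (true ∷_) V))
    ≡⟨ sym (cong₂ _+_ (cong sum (map-∘ V)) (cong sum (map-∘ V))) ⟩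
  sum (map (f ∘ (false ∷_)) V) + sum (map (f ∘ (true ∷_)) V)
    ≡⟨ sym (sum-map-+ (f ∘ (false ∷_)) (f ∘ (true ∷_)) V) ⟩
  ∑ (λ b → f (false ∷ b) + f (true ∷ b)) ∎
  where
    open ≡-Reasoning
    V = allVertices d

∣∣≡∑χ : {d : ℕ} (S : VSet d) → ∣ S ∣ ≡ ∑ (χ ∘ S)
∣∣≡∑χ {d} S = length-filter-T? S (allVertices d)

∂-intro : {d : ℕ} (A : VSet d) (u v : Vertex d) → ¬ T (A v) → T (A u) → dist u v ≡ 1 → T (∂ A v)
∂-intro A u v v∉A u∈A uv≡1 =
  from T-∧ (T-not-intro v∉A , any⁺ _ (lose (∈-allVertices u) (from T-∧ (u∈A , fromWitness uv≡1))))

∂-elim : {d : ℕ} {A : VSet d} {v : Vertex d} → T (∂ A v) → ∃ λ u → T (A u) × dist u v ≡ 1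
∂-elim {d} v∈∂A with u , u∈A∧uv≡1 ← satisfied (any⁻ _ (allVertices d) (proj₂ (to T-∧ v∈∂A))) =
  let u∈A , uv≡1 = to T-∧ u∈A∧uv≡1 in u , u∈A , toWitness uv≡1

dist-self : {d : ℕ} (u : Vertex d) → dist u u ≡ 0
dist-self []          = refl
dist-self (false ∷ u) = dist-self u
dist-self (true ∷ u)  = dist-self u

dist≡0⇒≡ : {d : ℕ} {u v : Vertex d} → dist u v ≡ 0 → u ≡ v
dist≡0⇒≡ {u = []}        {[]}        _  = refl
dist≡0⇒≡ {u = false ∷ u} {false ∷ v} uv = cong (false ∷_) (dist≡0⇒≡ uv)
dist≡0⇒≡ {u = true ∷ u}  {true ∷ v}  uv = cong (true ∷_) (dist≡0⇒≡ uv)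

isEvenVertex : {d : ℕ} → Vertex d → Bool
isEvenVertex v = isEvenℕ (coordSum v)

isEvenVertex-∷ : {d : ℕ} (c : Bool) (b : Vertex d) → isEvenVertex (c ∷ b) ≡ not (c xor isEvenVertex b)
isEvenVertex-∷ false b = refl
isEvenVertex-∷ {d} true b = cong isEvenℕ (+-suc (suc d) (twos b))

isEvenVertex-adjacent : {d : ℕ} (u v : Vertex d) → dist u v ≡ 1 → isEvenVertex u ≡ not (isEvenVertex v)
isEvenVertex-adjacent [] [] ()
isEvenVertex-adjacent (false ∷ u) (false ∷ v) uv = cong not (isEvenVertex-adjacent u v uv)
isEvenVertex-adjacent (true ∷ u)  (true ∷ v)  uv = begin
  isEvenVertex (true ∷ u)          ≡⟨ isEvenVertex-∷ true u ⟩
  not (not (isEvenVertex u))       ≡⟨ cong (not ∘ not) (isEvenVertex-adjacent u v uv) ⟩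
  not (not (not (isEvenVertex v))) ≡⟨ cong not (sym (isEvenVertex-∷ true v)) ⟩
  not (isEvenVertex (true ∷ v))    ∎
  where open ≡-Reasoning
isEvenVertex-adjacent (false ∷ u) (true ∷ v)  uv with refl ← dist≡0⇒≡ {u = u} {v} (suc-injective uv) =
  trans (sym (not-involutive _)) (cong not (sym (isEvenVertex-∷ true u)))
isEvenVertex-adjacent (true ∷ u)  (false ∷ v) uv with refl ← dist≡0⇒≡ {u = u} {v} (suc-injective uv) =
  isEvenVertex-∷ true u

evenLift oddLift : {d : ℕ} → Vertex d → Vertex (suc d)
evenLift b = isEvenVertex b ∷ b
oddLift  b = not (isEvenVertex b) ∷ b

even-∷⇒evenLift : {d : ℕ} (c : Bool) (b : Vertex d) → T (isEvenVertex (c ∷ b)) → c ≡ isEvenVertex b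
even-∷⇒evenLift c b even = xnor⇒≡ c (isEvenVertex b) (subst T (isEvenVertex-∷ c b) even)
  where
    xnor⇒≡ : ∀ x y → T (not (x xor y)) → x ≡ y
    xnor⇒≡ false false _ = refl
    xnor⇒≡ true  true  _ = refl

dist-evenLift-oddLift : {d : ℕ} (b : Vertex d) → dist (evenLift b) (oddLift b) ≡ 1
dist-evenLift-oddLift b = cong₂ (λ x y → χ x + y) (xor-inverseʳ (isEvenVertex b)) (dist-self b)

dist-evenLift-oddLift-adjacent : {d : ℕ} (u b : Vertex d) → dist u b ≡ 1 →
  dist (evenLift u) (oddLift b) ≡ 1
dist-evenLift-oddLift-adjacent u b ub = cong₂ (λ x y → χ x + y) heads-agree ub
  where
    heads-agree : isEvenVertex u xor not (isEvenVertex b) ≡ false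
    heads-agree = trans (cong (_xor not (isEvenVertex b)) (isEvenVertex-adjacent u b ub))
                        (xor-same (not (isEvenVertex b)))

projection : {d : ℕ} → VSet (suc d) → VSet d
projection A b = A (false ∷ b) ∨ A (true ∷ b)

fibreSize : {d : ℕ} → VSet (suc d) → Vertex d → ℕ
fibreSize S b = χ (S (false ∷ b)) + χ (S (true ∷ b))

χ-∷≤fibreSize : {d : ℕ} (S : VSet (suc d)) (c : Bool) (b : Vertex d) → χ (S (c ∷ b)) ≤ fibreSize S b
χ-∷≤fibreSize S false b = m≤m+n _ _
χ-∷≤fibreSize S true  b = m≤n+m _ _

∣∣≡∑fibreSize : {d : ℕ} (S : VSet (suc d)) → ∣ S ∣ ≡ ∑ (fibreSize S)
∣∣≡∑fibreSize S = trans (∣∣≡∑χ S) (∑-suc (χ ∘ S))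

module _ {d : ℕ} {A : VSet (suc d)} (even : EvenSet A) where

  ∈A⇒evenLift : {c : Bool} {b : Vertex d} → T (A (c ∷ b)) → T (A (evenLift b))
  ∈A⇒evenLift {c} {b} c∷b∈A = subst (λ c → T (A (c ∷ b))) (even-∷⇒evenLift c b (even _ c∷b∈A)) c∷b∈A

  oddLift∉A : (b : Vertex d) → ¬ T (A (oddLift b))
  oddLift∉A b oddLift∈A = not-¬ refl (sym (even-∷⇒evenLift _ b (even _ oddLift∈A)))

  projection⇒evenLift : {b : Vertex d} → T (projection A b) → T (A (evenLift b))
  projection⇒evenLift b∈B with to T-∨ b∈B
  ... | inj₁ false∷b∈A = ∈A⇒evenLift false∷b∈A
  ... | inj₂ true∷b∈A  = ∈A⇒evenLift true∷b∈A

  fibre-disjoint : (b : Vertex d) → ¬ (T (A (false ∷ b)) × T (A (true ∷ b)))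
  fibre-disjoint b (false∷b∈A , true∷b∈A)
    with trans (even-∷⇒evenLift false b (even _ false∷b∈A)) (sym (even-∷⇒evenLift true b (even _ true∷b∈A)))
  ... | ()

  χ-projection : (b : Vertex d) → χ (projection A b) ≡ fibreSize A b
  χ-projection b = χ-∨-disjoint (fibre-disjoint b)

  ∣projection∣≡∣∣ : ∣ projection A ∣ ≡ ∣ A ∣
  ∣projection∣≡∣∣ = trans (∣∣≡∑χ (projection A)) (trans (∑-cong χ-projection) (sym (∣∣≡∑fibreSize A)))

  closedNeighbourhood⇒oddLift∈∂ : {b : Vertex d} →
    T ((projection A ∪ ∂ (projection A)) b) → T (∂ A (oddLift b))
  closedNeighbourhood⇒oddLift∈∂ {b} b∈B∪∂B with to T-∨ b∈B∪∂B
  ... | inj₁ b∈B =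
    ∂-intro A (evenLift b) (oddLift b) (oddLift∉A b) (projection⇒evenLift b∈B)
      (dist-evenLift-oddLift b)
  ... | inj₂ b∈∂B with u , u∈B , ub ← ∂-elim b∈∂B =
    ∂-intro A (evenLift u) (oddLift b) (oddLift∉A b) (projection⇒evenLift u∈B)
      (dist-evenLift-oddLift-adjacent u b ub)

  ∣closedNeighbourhood∣≤∣∂∣ : ∣ projection A ∪ ∂ (projection A) ∣ ≤ ∣ ∂ A ∣
  ∣closedNeighbourhood∣≤∣∂∣ = begin
    ∣ B ∪ ∂ B ∣                  ≡⟨ ∣∣≡∑χ (B ∪ ∂ B) ⟩
    ∑ (χ ∘ (B ∪ ∂ B))            ≤⟨ ∑-mono (λ b → ≤-trans (χ-mono closedNeighbourhood⇒oddLift∈∂)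
                                                          (χ-∷≤fibreSize (∂ A) _ b)) ⟩
    ∑ (fibreSize (∂ A))          ≡⟨ sym (∣∣≡∑fibreSize (∂ A)) ⟩
    ∣ ∂ A ∣                      ∎
    where
      open ≤-Reasoning
      B = projection A

lemma4p2 : (n : ℕ) → 1 ≤ n → (A : VSet (suc n)) → EvenSet A →
    Σ (VSet n) (λ B → (∣ B ∣ ≡ ∣ A ∣) × (∣ B ∪ ∂ B ∣ ≤ ∣ ∂ A ∣))
lemma4p2 n _ A even = projection A , ∣projection∣≡∣∣ even , ∣closedNeighbourhood∣≤∣∂∣ even
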